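{- Let $k\ge3$ and let $p\ge1$ be an integer with $p_i=p$ for all $3\le i\le k$. Then for all integers $j\ge0$ and $n\ge1$ such that $\binom{k+j-3}{k-2}<n\le\binom{k+j-2}{k-2}$, $$\mathrm{G}^1_k(n)=\sum_{m=0}^{j-1}\binom{k+m-3}{k-3}p^m+\left(n-\binom{k+j-3}{k-2}\right)p^j.$$
   Context: $\mathrm{G}^1_k(n)$ is defined by $\mathrm{G}^1_k(0)=0$ for $k\ge3$; $\mathrm{G}^1_3(n)=p_3\mathrm{G}^1_3(n-1)+1$ for $n\ge1$; and $\mathrm{G}^1_k(n)=\min_{1\le t\le n}\{p_k\mathrm{G}^1_k(n-t)+\mathrm{G}^1_{k-1}(t)\}$ for $k\ge4$, $n\ge1$. -}

module Defs where

open import Data.Nat using (ℕ; zero; suc; _+_; _*_; _⊓_; _∸_)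
open import Data.List using (List; []; _∷_)

-- G¹_k(n) with p_i = p for all i ≥ 3, indexed by d = k - 3 (so k = 3 + d).

-- minimum over a nonempty-in-use list; the value for [] is never used here
-- because the lists below always have length n+1 ≥ 1.
mutual
  G : ℕ → ℕ → ℕ → ℕ
  G p d n with Gs p d n
  ... | x ∷ _ = x
  ... | []    = 0

  -- Gs p d n = [ G¹_{3+d}(n) , G¹_{3+d}(n-1) , … , G¹_{3+d}(0) ]
  Gs : ℕ → ℕ → ℕ → List ℕ
  Gs p d zero = 0 ∷ []
  Gs p zero (suc n) with Gs p zero n
  ... | xs@(x ∷ _) = (p * x + 1) ∷ xs
  ... | []         = []
  Gs p (suc d) (suc n) = minStep p d 1 (Gs p (suc d) n) ∷ Gs p (suc d) n

  -- minStep p d t [G(m), G(m-1), …, G(0)] = min over the entries, entry i (0-based)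
  --   weighted as  p * G(m - i) + G¹_{3+d}(t + i)
  minStep : ℕ → ℕ → ℕ → List ℕ → ℕ
  minStep p d t [] = 0
  minStep p d t (x ∷ []) = p * x + G p d t
  minStep p d t (x ∷ y ∷ ys) = (p * x + G p d t) ⊓ minStep p d (suc t) (y ∷ ys)

G¹ : ℕ → (k : ℕ) → ℕ → ℕ
G¹ p k n = G p (k ∸ 3) n

Σ< : ℕ → (ℕ → ℕ) → ℕ
Σ< zero f = 0
Σ< (suc j) f = Σ< j f + f j

module Submission where

-- Write k = 3 + d and consider the multiset containing p^m with multiplicity
-- layer d m = C(d+m, d).  Let greedy d n be the sum of its n smallest
-- elements: the (i+1)-st smallest is p^(level d i), where level d i is the
-- block j with below d j ≤ i < below d (j+1) and below d j = C(d+j, d+1).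
-- On block j the function greedy d is linear with slope p^j, which gives the
-- closed form  greedy d n = Σ_{m<j} C(d+m, d) p^m + (n - below d j) p^j,
-- i.e. the right-hand side of the theorem.  It remains to show that
-- G¹_{3+d} = greedy d, i.e. that greedy satisfies the defining recursion:
--   * d = 0: greedy 0 n = 1 + p + ⋯ + p^(n-1) solves G(n) = p·G(n-1) + 1;
--   * d+1:  the split cost t ↦ p·greedy (d+1) (n-t) + greedy d t moves by
--     p^(level d t) against p^(1 + level (d+1) (n-1-t)), so it falls and then
--     rises; it is minimal at a balanced split point, where the Pascal
--     identities for layer, below and the block sums show that its value is
--     greedy (d+1) n.

open import Defs
open import Data.Nat using (ℕ; zero; suc; _+_; _*_; _∸_; _^_; _≤_; _<_; z≤n; s≤s; _≤?_; NonZero)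
open import Data.Nat.Properties
open import Data.Nat.Combinatorics using (_C_; nCn≡1; nCk+nC[k+1]≡[n+1]C[k+1])
open import Data.Nat.Combinatorics.Specification using (k>n⇒nCk≡0)
open import Data.Nat.Solver using (module +-*-Solver)
open import Data.List using (List; []; _∷_)
open import Data.Product using (∃-syntax; _×_; _,_; proj₁; proj₂)
open import Data.Sum using (inj₁; inj₂)
open import Relation.Nullary using (yes; no)
open import Relation.Binary.PropositionalEquality
open import Data.Empty using (⊥-elim)

open +-*-Solver using (solve; _:+_; _:*_; _:=_; con)

Σ<-cong : ∀ j {f g : ℕ → ℕ} → (∀ m → f m ≡ g m) → Σ< j f ≡ Σ< j g
Σ<-cong zero    f≗g = refl
Σ<-cong (suc j) f≗g = cong₂ _+_ (Σ<-cong j f≗g) (f≗g j)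

∸-+-interchange : ∀ {a b c e} → b ≤ a → e ≤ c → (a ∸ b) + (c ∸ e) ≡ (a + c) ∸ (b + e)
∸-+-interchange {a} {b} {c} {e} b≤a e≤c = begin
    (a ∸ b) + (c ∸ e)
  ≡⟨ sym (+-∸-assoc (a ∸ b) e≤c) ⟩
    ((a ∸ b) + c) ∸ e
  ≡⟨ cong (_∸ e) (sym (+-∸-comm c b≤a)) ⟩
    ((a + c) ∸ b) ∸ e
  ≡⟨ ∸-+-assoc (a + c) b e ⟩
    (a + c) ∸ (b + e)
  ∎
  where open ≡-Reasoning

split-between : ∀ {a a' b b' N} → a ≤ a' → b ≤ b' → a + b ≤ N → N ≤ a' + b' → 0 < a' → b < N →
  ∃[ t ] (0 < t × t ≤ N × a ≤ t × t ≤ a' × b ≤ N ∸ t × N ∸ t ≤ b')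
split-between {a} {a'} {b} {b'} {N} a≤a' b≤b' lo hi a'>0 b<N with ≤-total a' (N ∸ b)
... | inj₁ a'≤N∸b =
  a' , a'>0 , ≤-trans a'≤N∸b (m∸n≤m N b) , a≤a' , ≤-refl ,
  m+n≤o⇒m≤o∸n b (subst (_≤ N) (+-comm a' b) (m≤o∸n⇒m+n≤o a' (<⇒≤ b<N) a'≤N∸b)) ,
  m≤n+o⇒m∸n≤o N a' hi
... | inj₂ N∸b≤a' =
  N ∸ b , m<n⇒0<n∸m b<N , m∸n≤m N b , m+n≤o⇒m≤o∸n a lo , N∸b≤a' ,
  ≤-reflexive (sym N∸[N∸b]≡b) , subst (_≤ b') (sym N∸[N∸b]≡b) b≤b'
  where
  N∸[N∸b]≡b : N ∸ (N ∸ b) ≡ b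
  N∸[N∸b]≡b = m∸[m∸n]≡n (<⇒≤ b<N)

rising-from : (h : ℕ → ℕ) {a b : ℕ} → (∀ t → a ≤ t → t < b → h t ≤ h (suc t)) →
  ∀ t → a ≤ t → t ≤ b → h a ≤ h t
rising-from h rise zero    z≤n  _      = ≤-refl
rising-from h rise (suc t) a≤1+t 1+t≤b with m≤n⇒m<n∨m≡n a≤1+t
... | inj₂ refl = ≤-refl
... | inj₁ a<1+t =
  ≤-trans (rising-from h rise t (≤-pred a<1+t) (<⇒≤ 1+t≤b)) (rise t (≤-pred a<1+t) 1+t≤b)

falling-to : (h : ℕ → ℕ) {a : ℕ} → (∀ t → suc t ≤ a → h (suc t) ≤ h t) → ∀ t → t ≤ a → h a ≤ h t
falling-to h {zero}  fall .zero z≤n = ≤-refl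
falling-to h {suc a} fall t t≤1+a with m≤n⇒m<n∨m≡n t≤1+a
... | inj₂ refl = ≤-refl
... | inj₁ t<1+a =
  ≤-trans (fall a ≤-refl) (falling-to h (λ u u<a → fall u (≤-trans u<a (n≤1+n a))) t (≤-pred t<1+a))

valley-min : (h : ℕ → ℕ) {t₀ N : ℕ} → (∀ t → suc t ≤ t₀ → h (suc t) ≤ h t) →
  (∀ t → t₀ ≤ t → t < N → h t ≤ h (suc t)) → ∀ t → t ≤ N → h t₀ ≤ h t
valley-min h {t₀} fall rise t t≤N with ≤-total t₀ t
... | inj₁ t₀≤t = rising-from h rise t t₀≤t t≤N
... | inj₂ t≤t₀ = falling-to h fall t t≤t₀

-- layer d m = C(d+m, d) (see layer≡C): the multiplicity of p^m at depth d.
-- It satisfies Pascal's rule in the form used by the recursion on d.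
layer : ℕ → ℕ → ℕ
layer zero    m       = 1
layer (suc d) zero    = 1
layer (suc d) (suc m) = layer d (suc m) + layer (suc d) m

layer-zero : ∀ d → layer d 0 ≡ 1
layer-zero zero    = refl
layer-zero (suc d) = refl

-- Every block is nonempty, so the block boundaries increase strictly.
layer-pos : ∀ d m → 0 < layer d m
layer-pos zero    m       = s≤s z≤n
layer-pos (suc d) zero    = s≤s z≤n
layer-pos (suc d) (suc m) = ≤-trans (layer-pos d (suc m)) (m≤m+n _ _)

-- below d j = layer d 0 + ⋯ + layer d (j-1) = C(d+j, d+1): the number of
-- elements of the multiset smaller than p^j.
below : ℕ → ℕ → ℕ
below d j = Σ< j (layer d)

below-mono : ∀ d {m m'} → m ≤ m' → below d m ≤ below d m'
below-mono d {m' = zero}    z≤n    = ≤-refl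
below-mono d {m' = suc m'} m≤1+m' with m≤n⇒m<n∨m≡n m≤1+m'
... | inj₂ refl = ≤-refl
... | inj₁ m<1+m' = ≤-trans (below-mono d (≤-pred m<1+m')) (m≤m+n _ _)

below-pos : ∀ d j → 0 < below d (suc j)
below-pos d j = ≤-trans (layer-pos d j) (m≤n+m (layer d j) (below d j))

below-pascal : ∀ d j → below (suc d) j ≡ below d j + below (suc d) (j ∸ 1)
below-pascal d zero          = refl
below-pascal d (suc zero)    = sym (trans (+-identityʳ _) (layer-zero d))
below-pascal d (suc (suc i)) = begin
    below (suc d) (suc i) + (layer d (suc i) + layer (suc d) i)
  ≡⟨ cong (_+ (layer d (suc i) + layer (suc d) i)) (below-pascal d (suc i)) ⟩
    (below d (suc i) + below (suc d) i) + (layer d (suc i) + layer (suc d) i)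
  ≡⟨ solve 4 (λ a b x y → (a :+ b) :+ (x :+ y) := (a :+ x) :+ (b :+ y)) refl
       (below d (suc i)) (below (suc d) i) (layer d (suc i)) (layer (suc d) i) ⟩
    (below d (suc i) + layer d (suc i)) + (below (suc d) i + layer (suc d) i)
  ∎
  where open ≡-Reasoning

level : ℕ → ℕ → ℕ
level d zero = 0
level d (suc i) with below d (suc (level d i)) ≤? suc i
... | yes _ = suc (level d i)
... | no  _ = level d i

level-spec : ∀ d i → below d (level d i) ≤ i × i < below d (suc (level d i))
level-spec d zero = z≤n , layer-pos d 0
level-spec d (suc i) with below d (suc (level d i)) ≤? suc i | level-spec d i
... | yes reached | _ , i<next =
  reached , ≤-trans (s≤s i<next) (m<m+n (below d (suc (level d i))) (layer-pos d (suc (level d i))))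
... | no  ¬reached | start≤i , _ = ≤-trans start≤i (n≤1+n i) , ≰⇒> ¬reached

level-≥ : ∀ d {m i} → below d m ≤ i → m ≤ level d i
level-≥ d {m} {i} start≤i with m ≤? level d i
... | yes m≤ = m≤
... | no  m≰ =
  ⊥-elim (<⇒≱ (proj₂ (level-spec d i)) (≤-trans (below-mono d (≰⇒> m≰)) start≤i))

level-< : ∀ d {m i} → i < below d m → level d i < m
level-< d {m} {i} i<end with suc (level d i) ≤? m
... | yes lt = lt
... | no  ≮  =
  ⊥-elim (<⇒≱ i<end (≤-trans (below-mono d (≤-pred (≰⇒> ≮))) (proj₁ (level-spec d i))))

level-unique : ∀ d {j i} → below d j ≤ i → i < below d (suc j) → level d i ≡ j
level-unique d start≤i i<end = ≤-antisym (≤-pred (level-< d i<end)) (level-≥ d start≤i)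

below₀ : ∀ j → below 0 j ≡ j
below₀ zero    = refl
below₀ (suc j) = trans (cong (_+ 1) (below₀ j)) (+-comm j 1)

level₀ : ∀ i → level 0 i ≡ i
level₀ i = level-unique 0 (≤-reflexive (below₀ i)) (subst (i <_) (sym (below₀ (suc i))) ≤-refl)

module Greedy (p : ℕ) .{{_ : NonZero p}} where

  greedy : ℕ → ℕ → ℕ
  greedy d n = Σ< n (λ i → p ^ level d i)

  blockSum : ℕ → ℕ → ℕ
  blockSum d j = Σ< j (λ m → layer d m * p ^ m)

  greedy-in-block : ∀ d j r → r ≤ layer d j → greedy d (below d j + r) ≡ greedy d (below d j) + r * p ^ j
  greedy-in-block d j zero    _ = trans (cong (greedy d) (+-identityʳ (below d j))) (sym (+-identityʳ (greedy d (below d j))))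
  greedy-in-block d j (suc r) r<size = begin
      greedy d (below d j + suc r)
    ≡⟨ cong (greedy d) (+-suc (below d j) r) ⟩
      greedy d (below d j + r) + p ^ level d (below d j + r)
    ≡⟨ cong₂ _+_ (greedy-in-block d j r (<⇒≤ r<size))
                 (cong (p ^_) (level-unique d (m≤m+n _ _) (+-monoʳ-< (below d j) r<size))) ⟩
      greedy d (below d j) + r * p ^ j + p ^ j
    ≡⟨ trans (+-assoc (greedy d (below d j)) (r * p ^ j) (p ^ j)) (cong (greedy d (below d j) +_) (+-comm (r * p ^ j) (p ^ j))) ⟩
      greedy d (below d j) + suc r * p ^ j
    ∎
    where open ≡-Reasoning

  greedy-below : ∀ d j → greedy d (below d j) ≡ blockSum d j
  greedy-below d zero    = refl
  greedy-below d (suc j) =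
    trans (greedy-in-block d j (layer d j) ≤-refl) (cong (_+ layer d j * p ^ j) (greedy-below d j))

  greedy-closed : ∀ d j x → below d j ≤ x → x ≤ below d (suc j) →
    greedy d x ≡ blockSum d j + (x ∸ below d j) * p ^ j
  greedy-closed d j x start≤x x≤end = begin
      greedy d x
    ≡⟨ cong (greedy d) (sym (m+[n∸m]≡n start≤x)) ⟩
      greedy d (below d j + (x ∸ below d j))
    ≡⟨ greedy-in-block d j (x ∸ below d j) (m≤n+o⇒m∸n≤o x (below d j) x≤end) ⟩
      greedy d (below d j) + (x ∸ below d j) * p ^ j
    ≡⟨ cong (_+ (x ∸ below d j) * p ^ j) (greedy-below d j) ⟩
      blockSum d j + (x ∸ below d j) * p ^ j
    ∎
    where open ≡-Reasoning

  blockSum-pascal : ∀ d j → blockSum (suc d) j ≡ p * blockSum (suc d) (j ∸ 1) + blockSum d j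
  blockSum-pascal d zero          = sym (trans (+-identityʳ _) (*-zeroʳ p))
  blockSum-pascal d (suc zero)    = sym (cong₂ _+_ (*-zeroʳ p) (cong (_* 1) (layer-zero d)))
  blockSum-pascal d (suc (suc i)) =
    trans (cong (_+ (layer d (suc i) + layer (suc d) i) * (p * p ^ i)) (blockSum-pascal d (suc i)))
      (solve 6 (λ p X Y a b P → (p :* X :+ Y) :+ (a :+ b) :* (p :* P)
                                := p :* (X :+ b :* P) :+ (Y :+ a :* (p :* P))) refl
        p (blockSum (suc d) i) (blockSum d (suc i)) (layer d (suc i)) (layer (suc d) i) (p ^ i))

  geometric-step : ∀ n → Σ< (suc n) (p ^_) ≡ p * Σ< n (p ^_) + 1
  geometric-step zero    = cong (_+ 1) (sym (*-zeroʳ p))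
  geometric-step (suc n) = trans (cong (_+ p * p ^ n) (geometric-step n))
    (solve 3 (λ p X P → (p :* X :+ con 1) :+ p :* P := p :* (X :+ P) :+ con 1) refl p (Σ< n (p ^_)) (p ^ n))

  greedy₀-step : ∀ n → greedy 0 (suc n) ≡ p * greedy 0 n + 1
  greedy₀-step n = begin
      greedy 0 (suc n)
    ≡⟨ Σ<-cong (suc n) (λ i → cong (p ^_) (level₀ i)) ⟩
      Σ< (suc n) (p ^_)
    ≡⟨ geometric-step n ⟩
      p * Σ< n (p ^_) + 1
    ≡⟨ cong (λ x → p * x + 1) (sym (Σ<-cong n (λ i → cong (p ^_) (level₀ i)))) ⟩
      p * greedy 0 n + 1
    ∎
    where open ≡-Reasoning

  cost : ℕ → ℕ → ℕ → ℕ
  cost d n t = p * greedy (suc d) (n ∸ t) + greedy d t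

  -- Moving the split point from t to t+1 trades p·p^(level (d+1) (n-t))
  -- for p^(level d t); the sign of the change is decided by the exponents.
  cost-before : ∀ d n t → t ≤ n →
    cost d (suc n) t ≡ (p * greedy (suc d) (n ∸ t) + greedy d t) + p ^ suc (level (suc d) (n ∸ t))
  cost-before d n t t≤n =
    trans (cong (λ u → p * greedy (suc d) u + greedy d t) (+-∸-assoc 1 t≤n))
      (solve 4 (λ p X P Y → p :* (X :+ P) :+ Y := (p :* X :+ Y) :+ p :* P) refl
        p (greedy (suc d) (n ∸ t)) (p ^ level (suc d) (n ∸ t)) (greedy d t))

  cost-after : ∀ d n t →
    cost d (suc n) (suc t) ≡ (p * greedy (suc d) (n ∸ t) + greedy d t) + p ^ level d t
  cost-after d n t = sym (+-assoc (p * greedy (suc d) (n ∸ t)) (greedy d t) (p ^ level d t))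

  cost-rises : ∀ d n t → t ≤ n → suc (level (suc d) (n ∸ t)) ≤ level d t →
    cost d (suc n) t ≤ cost d (suc n) (suc t)
  cost-rises d n t t≤n exps = subst₂ _≤_ (sym (cost-before d n t t≤n)) (sym (cost-after d n t))
    (+-monoʳ-≤ (p * greedy (suc d) (n ∸ t) + greedy d t) (^-monoʳ-≤ p exps))

  cost-falls : ∀ d n t → t ≤ n → level d t ≤ suc (level (suc d) (n ∸ t)) →
    cost d (suc n) (suc t) ≤ cost d (suc n) t
  cost-falls d n t t≤n exps = subst₂ _≤_ (sym (cost-after d n t)) (sym (cost-before d n t t≤n))
    (+-monoʳ-≤ (p * greedy (suc d) (n ∸ t) + greedy d t) (^-monoʳ-≤ p exps))

  scaled-closed : ∀ d j s → below (suc d) (j ∸ 1) ≤ s → s ≤ below (suc d) j →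
    p * greedy (suc d) s ≡ p * blockSum (suc d) (j ∸ 1) + (s ∸ below (suc d) (j ∸ 1)) * p ^ j
  scaled-closed d zero    .zero _ z≤n = sym (+-identityʳ (p * 0))
  scaled-closed d (suc i) s start≤s s≤end =
    trans (cong (p *_) (greedy-closed (suc d) i s start≤s s≤end))
      (solve 4 (λ p S x P → p :* (S :+ x :* P) := p :* S :+ x :* (p :* P)) refl
        p (blockSum (suc d) i) (s ∸ below (suc d) i) (p ^ i))

  balanced-cost : ∀ d j t s → below d j ≤ t → t ≤ below d (suc j) →
    below (suc d) (j ∸ 1) ≤ s → s ≤ below (suc d) j →
    p * greedy (suc d) s + greedy d t ≡ greedy (suc d) (t + s)
  balanced-cost d j t s t-lo t-hi s-lo s-hi = begin
      p * greedy (suc d) s + greedy d t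
    ≡⟨ cong₂ _+_ (scaled-closed d j s s-lo s-hi) (greedy-closed d j t t-lo t-hi) ⟩
      (p * blockSum (suc d) (j ∸ 1) + (s ∸ B) * p ^ j) + (blockSum d j + (t ∸ A) * p ^ j)
    ≡⟨ solve 5 (λ X Y u v P → (X :+ v :* P) :+ (Y :+ u :* P) := (X :+ Y) :+ (u :+ v) :* P) refl
         (p * blockSum (suc d) (j ∸ 1)) (blockSum d j) (t ∸ A) (s ∸ B) (p ^ j) ⟩
      (p * blockSum (suc d) (j ∸ 1) + blockSum d j) + ((t ∸ A) + (s ∸ B)) * p ^ j
    ≡⟨ cong₂ _+_ (sym (blockSum-pascal d j))
                 (cong (_* p ^ j) (trans (∸-+-interchange t-lo s-lo) (cong (t + s ∸_) (sym (below-pascal d j))))) ⟩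
      blockSum (suc d) j + (t + s ∸ below (suc d) j) * p ^ j
    ≡⟨ sym (greedy-closed (suc d) j (t + s) total-lo total-hi) ⟩
      greedy (suc d) (t + s)
    ∎
    where
    open ≡-Reasoning
    A = below d j
    B = below (suc d) (j ∸ 1)
    total-lo : below (suc d) j ≤ t + s
    total-lo = subst (_≤ t + s) (sym (below-pascal d j)) (+-mono-≤ t-lo s-lo)
    total-hi : t + s ≤ below (suc d) (suc j)
    total-hi = subst (t + s ≤_) (sym (below-pascal d (suc j))) (+-mono-≤ t-hi s-hi)

  balanced-min : ∀ d j n t₀ → below d j ≤ t₀ → t₀ ≤ below d (suc j) →
    below (suc d) (j ∸ 1) ≤ suc n ∸ t₀ → suc n ∸ t₀ ≤ below (suc d) j → t₀ ≤ suc n →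
    ∀ t → t ≤ suc n → cost d (suc n) t₀ ≤ cost d (suc n) t
  balanced-min d j n t₀ t-lo t-hi s-lo s-hi t₀≤N = valley-min (cost d (suc n)) falls rises
    where
    -- left of t₀: level d t ≤ j ≤ 1 + level (d+1) (n-t)
    falls : ∀ t → suc t ≤ t₀ → cost d (suc n) (suc t) ≤ cost d (suc n) t
    falls t t<t₀ = cost-falls d n t (≤-pred (≤-trans t<t₀ t₀≤N))
      (≤-trans (≤-pred (level-< d (≤-trans t<t₀ t-hi)))
        (≤-trans (m≤n+m∸n j 1) (s≤s (level-≥ (suc d) (≤-trans s-lo (∸-monoʳ-≤ (suc n) t<t₀))))))
    -- right of t₀: 1 + level (d+1) (n-t) ≤ j ≤ level d t
    rises : ∀ t → t₀ ≤ t → t < suc n → cost d (suc n) t ≤ cost d (suc n) (suc t)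
    rises t t₀≤t t<N = cost-rises d n t (≤-pred t<N)
      (≤-trans (level-< (suc d) {j} n∸t<end) (level-≥ d {j} (≤-trans t-lo t₀≤t)))
      where
      n∸t<end : n ∸ t < below (suc d) j
      n∸t<end = ≤-trans (≤-reflexive (sym (+-∸-assoc 1 (≤-pred t<N))))
                        (≤-trans (∸-monoʳ-≤ (suc n) t₀≤t) s-hi)

  mutual
    greedys : ℕ → ℕ → List ℕ
    greedys d n = greedy d n ∷ greedys-below d n

    greedys-below : ℕ → ℕ → List ℕ
    greedys-below d zero    = []
    greedys-below d (suc n) = greedys d n

  -- Once G¹_{3+d} = greedy d, minStep over greedys (d+1) m starting at
  -- position t is the minimum of the cost of the splits t, …, t + m.
  module MinStep (d : ℕ) (G≡ : ∀ t → G p d t ≡ greedy d t) where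

    first-entry : ∀ N t m → t + m ≡ N → p * greedy (suc d) m + G p d t ≡ cost d N t
    first-entry N t m t+m≡N = cong₂ _+_
      (cong (λ u → p * greedy (suc d) u) (sym (trans (cong (_∸ t) (sym t+m≡N)) (m+n∸m≡n t m))))
      (G≡ t)

    minStep-≤ : ∀ N t m → t + m ≡ N → ∀ t' → t ≤ t' → t' ≤ N →
      minStep p d t (greedys (suc d) m) ≤ cost d N t'
    minStep-≤ N t zero t+0≡N t' t≤t' t'≤N =
      ≤-reflexive (trans (first-entry N t 0 t+0≡N) (cong (cost d N) t≡t'))
      where
      t≡t' : t ≡ t'
      t≡t' = ≤-antisym t≤t' (subst (t' ≤_) (trans (sym t+0≡N) (+-identityʳ t)) t'≤N)
    minStep-≤ N t (suc m) t+1+m≡N t' t≤t' t'≤N with m≤n⇒m<n∨m≡n t≤t'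
    ... | inj₂ t≡t' = ≤-trans (m⊓n≤m _ _)
      (≤-reflexive (trans (first-entry N t (suc m) t+1+m≡N) (cong (cost d N) t≡t')))
    ... | inj₁ t<t' = ≤-trans (m⊓n≤n _ _)
      (minStep-≤ N (suc t) m (trans (sym (+-suc t m)) t+1+m≡N) t' t<t' t'≤N)

    minStep-attained : ∀ N t m → t + m ≡ N →
      ∃[ t' ] (t ≤ t' × t' ≤ N × minStep p d t (greedys (suc d) m) ≡ cost d N t')
    minStep-attained N t zero t+0≡N =
      t , ≤-refl , subst (t ≤_) t+0≡N (m≤m+n t 0) , first-entry N t 0 t+0≡N
    minStep-attained N t (suc m) t+1+m≡N
      with ⊓-sel (p * greedy (suc d) (suc m) + G p d t) (minStep p d (suc t) (greedys (suc d) m))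
    ... | inj₁ first = t , ≤-refl , subst (t ≤_) t+1+m≡N (m≤m+n t (suc m)) ,
                       trans first (first-entry N t (suc m) t+1+m≡N)
    ... | inj₂ rest with minStep-attained N (suc t) m (trans (sym (+-suc t m)) t+1+m≡N)
    ... | t' , t<t' , t'≤N , value = t' , <⇒≤ t<t' , t'≤N , trans rest value

    minStep-balanced : ∀ n j t₀ → 0 < t₀ → t₀ ≤ suc n → below d j ≤ t₀ → t₀ ≤ below d (suc j) →
      below (suc d) (j ∸ 1) ≤ suc n ∸ t₀ → suc n ∸ t₀ ≤ below (suc d) j →
      minStep p d 1 (greedys (suc d) n) ≡ greedy (suc d) (suc n)
    minStep-balanced n j t₀ t₀>0 t₀≤N t-lo t-hi s-lo s-hi with minStep-attained (suc n) 1 n refl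
    ... | t , _ , t≤N , attained = ≤-antisym
      (≤-trans (minStep-≤ (suc n) 1 n refl t₀ t₀>0 t₀≤N) (≤-reflexive value))
      (subst₂ _≤_ value (sym attained) (balanced-min d j n t₀ t-lo t-hi s-lo s-hi t₀≤N t t≤N))
      where
      value : cost d (suc n) t₀ ≡ greedy (suc d) (suc n)
      value = trans (balanced-cost d j t₀ (suc n ∸ t₀) t-lo t-hi s-lo s-hi)
                    (cong (greedy (suc d)) (m+[n∸m]≡n t₀≤N))

    minStep-in-block : ∀ n j → below (suc d) j ≤ n → n < below (suc d) (suc j) →
      minStep p d 1 (greedys (suc d) n) ≡ greedy (suc d) (suc n)
    minStep-in-block n j n-lo n-hi
      with split-between (below-mono d (n≤1+n j)) (below-mono (suc d) (m∸n≤m j 1))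
             (subst (_≤ suc n) (below-pascal d j) (≤-trans n-lo (n≤1+n n)))
             (subst (suc n ≤_) (below-pascal d (suc j)) n-hi)
             (below-pos d j)
             (s≤s (≤-trans (below-mono (suc d) (m∸n≤m j 1)) n-lo))
    ... | t₀ , t₀>0 , t₀≤N , t-lo , t-hi , s-lo , s-hi =
      minStep-balanced n j t₀ t₀>0 t₀≤N t-lo t-hi s-lo s-hi

    minStep-greedy : ∀ n → minStep p d 1 (greedys (suc d) n) ≡ greedy (suc d) (suc n)
    minStep-greedy n = minStep-in-block n (level (suc d) n) (proj₁ spec) (proj₂ spec)
      where
      spec = level-spec (suc d) n

  mutual
    Gs≡greedys : ∀ d n → Gs p d n ≡ greedys d n
    Gs≡greedys d       zero    = refl
    Gs≡greedys zero    (suc n) rewrite Gs≡greedys zero n =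
      cong (_∷ greedys zero n) (sym (greedy₀-step n))
    Gs≡greedys (suc d) (suc n) rewrite Gs≡greedys (suc d) n =
      cong (_∷ greedys (suc d) n) (MinStep.minStep-greedy d (G≡greedy d) n)

    G≡greedy : ∀ d n → G p d n ≡ greedy d n
    G≡greedy d n rewrite Gs≡greedys d n = refl

layer≡C : ∀ d m → layer d m ≡ (d + m) C d
layer≡C zero    m       = refl
layer≡C (suc d) zero    =
  trans (sym (nCn≡1 (suc d))) (cong (λ x → x C suc d) (sym (+-identityʳ (suc d))))
layer≡C (suc d) (suc m) = begin
    layer d (suc m) + layer (suc d) m
  ≡⟨ cong₂ _+_ (trans (layer≡C d (suc m)) (cong (λ x → x C d) (+-suc d m))) (layer≡C (suc d) m) ⟩
    suc (d + m) C d + suc (d + m) C suc d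
  ≡⟨ nCk+nC[k+1]≡[n+1]C[k+1] (suc (d + m)) d ⟩
    suc (suc (d + m)) C suc d
  ≡⟨ cong (λ x → suc x C suc d) (sym (+-suc d m)) ⟩
    (suc d + suc m) C suc d
  ∎
  where open ≡-Reasoning

below≡C : ∀ d j → below d j ≡ (d + j) C suc d
below≡C d zero    = sym (trans (cong (λ x → x C suc d) (+-identityʳ d)) (k>n⇒nCk≡0 (n<1+n d)))
below≡C d (suc j) = begin
    below d j + layer d j
  ≡⟨ cong₂ _+_ (below≡C d j) (layer≡C d j) ⟩
    (d + j) C suc d + (d + j) C d
  ≡⟨ +-comm ((d + j) C suc d) ((d + j) C d) ⟩
    (d + j) C d + (d + j) C suc d
  ≡⟨ nCk+nC[k+1]≡[n+1]C[k+1] (d + j) d ⟩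
    suc (d + j) C suc d
  ≡⟨ cong (λ x → x C suc d) (sym (+-suc d j)) ⟩
    (d + suc j) C suc d
  ∎
  where open ≡-Reasoning

proposition3 : (k p : ℕ) → 3 ≤ k → 1 ≤ p → (j n : ℕ) → 1 ≤ n →
    (k + j ∸ 3) C (k ∸ 2) < n → n ≤ (k + j ∸ 2) C (k ∸ 2) →
    G¹ p k n ≡ Σ< j (λ m → ((k + m ∸ 3) C (k ∸ 3)) * p ^ m) + (n ∸ (k + j ∸ 3) C (k ∸ 2)) * p ^ j
proposition3 (suc (suc (suc d))) (suc q) (s≤s (s≤s (s≤s z≤n))) (s≤s z≤n) j n _ lo hi = begin
    G p d n
  ≡⟨ G≡greedy d n ⟩
    greedy d n
  ≡⟨ greedy-closed d j n n-lo n-hi ⟩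
    blockSum d j + (n ∸ below d j) * p ^ j
  ≡⟨ cong₂ _+_ (Σ<-cong j (λ m → cong (_* p ^ m) (layer≡C d m)))
               (cong (λ x → (n ∸ x) * p ^ j) (below≡C d j)) ⟩
    Σ< j (λ m → ((d + m) C d) * p ^ m) + (n ∸ (d + j) C suc d) * p ^ j
  ∎
  where
  open ≡-Reasoning
  p = suc q
  open Greedy p
  n-lo : below d j ≤ n
  n-lo = subst (_≤ n) (sym (below≡C d j)) (<⇒≤ lo)
  n-hi : n ≤ below d (suc j)
  n-hi = subst (n ≤_) (sym (trans (below≡C d (suc j)) (cong (λ x → x C suc d) (+-suc d j)))) hi
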